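{- Let $n$ be a positive integer and let $m=\delta p^{r}$, where $\delta,r$ are positive integers, $p\ge 5$ is a prime and $p\nmid \delta$. (i) If $p^{r}+\delta\frac{p-1}{2}\le n$, then there exist integers $1\le a<b\le n$ such that $b^3+b\equiv a^3+a\pmod{m}$. (ii) If $r=1$ and $p+\delta\, \ell_p(\delta)\le n$, then there exist integers $1\le a<b\le n$ such that $b^3+b\equiv a^3+a\pmod{m}$.
   Context: For a prime $p\ge 5$ and a positive integer $\delta$ with $p\nmid\delta$, $\ell_p(\delta)$ is the smallest positive integer $x$ such that the Legendre symbol $\big(\frac{ -3\delta^2x^2-12}{p}\big)\in\{0,1\}$. -}

module Defs where

open import Data.Nat as ℕ using (ℕ; _≤_; _<_)
open import Data.Integer as ℤ using (ℤ; +_; _-_; _*_; _+_; -_)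
open import Data.Integer.Divisibility using (_∣_)
open import Data.Product using (∃)
open import Data.Sum using (_⊎_)
open import Relation.Nullary using (¬_)

-- Legendre symbol (a/p) takes a value in {0,1} iff p ∣ a (value 0)
-- or a is a (nonzero) quadratic residue mod p (value 1).
LegendreIn01 : ℤ → ℕ → Set
LegendreIn01 a p = ((+ p) ∣ a) ⊎ (∃ λ (y : ℤ) → (+ p) ∣ (y * y - a))

EllCond : ℕ → ℕ → ℕ → Set
EllCond p δ x =
  LegendreIn01 (- (+ 3) * (+ δ) * (+ δ) * (+ x) * (+ x) - + 12) p

IsEll : ℕ → ℕ → ℕ → Set
IsEll p δ l =
  (1 ≤ l) × EllCond p δ l × (∀ x → 1 ≤ x → x < l → ¬ EllCond p δ x)
  where open import Data.Product using (_×_)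

_≡_[mod_] : ℕ → ℕ → ℕ → Set
a ≡ b [mod m ] = (+ m) ∣ ((+ a) - (+ b))

CollisionUpTo : ℕ → ℕ → Set
CollisionUpTo n m =
  ∃ λ a → ∃ λ b → (1 ≤ a) × (a < b) × (b ≤ n) ×
    ((b ℕ.^ 3 ℕ.+ b) ≡ (a ℕ.^ 3 ℕ.+ a) [mod m ])
  where open import Data.Product using (_×_)

{-# OPTIONS --safe #-}
-- Since b³ + b − (a³ + a) = D · Q(a, D) with D = b − a and Q(a, D) = 3a² + 3aD + D² + 1, it suffices
-- to find D = δd and a with p^r ∣ Q(a, D); reducing a modulo p^r then puts it in [1, p^r].
-- As 12 Q(a, D) = (6a + 3D)² + 3D² + 12, a root a of Q(·, D) modulo p is obtained from any Y with
-- Y² + 3D² + 12 ≡ 0 (mod p) by solving 6a + 3D ≡ Y. For (ii) such a Y exists for D = δℓ by the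
-- definition of ℓ. For (i), among the p + 1 numbers y² and −3x² − 12 (0 ≤ x, y ≤ (p − 1)/2) two agree
-- modulo p, which yields a point of Y² + 3X² + 12 ≡ 0; it can be moved to one with X, Y ≢ 0, and then
-- some 1 ≤ d ≤ (p − 1)/2 has δd ≡ ±X. Since Y ≢ 0 the root is simple and Hensel lifts it to p^r.
module Submission where

module CubicCollisions where
  open import Data.Nat.Base as ℕ using (ℕ; zero; suc; z≤n; s≤s; NonZero; _^_)
  import Data.Nat.Properties as ℕₚ
  open import Data.Nat.DivMod using (m≡m%n+[m/n]*n; m%n<n)
  import Data.Nat.Divisibility as ℕ∣
  open import Data.Nat.Primality using (Prime; euclidsLemma; prime⇒irreducible; prime⇒nonZero)
  open import Data.Nat.Coprimality using (prime⇒coprime; coprime-Bézout)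
  open import Data.Nat.GCD using (module Bézout)
  open import Data.Integer.Base as ℤ using (ℤ; +_; -_; _+_; _-_; _*_; _⊖_)
  open import Data.Integer.Properties using (pos-+; pos-*; abs-*; m-n≡m⊖n; ⊖-≥)
  open import Data.Integer.Divisibility.Signed
  open import Data.Integer.DivMod using (_%ℕ_; _/ℕ_; n%ℕd<d; a≡a%ℕn+[a/ℕn]*n)
  open import Data.Integer.Tactic.RingSolver using (solve-∀)
  open import Data.Fin.Base using (Fin; toℕ; fromℕ<)
  open import Data.Fin.Properties using (pigeonhole; toℕ≤pred[n]; fromℕ<-injective)
  open import Data.Product using (∃; ∃₂; _×_; _,_; proj₁; proj₂)
  open import Data.Sum using (_⊎_; inj₁; inj₂)
  open import Data.Empty using (⊥-elim)
  open import Relation.Nullary using (¬_; yes; no)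
  open import Relation.Binary.PropositionalEquality
  open import Defs using (EllCond; CollisionUpTo)

  ∣-lincomb : ∀ {k a b c} u v → k ∣ a → k ∣ b → c ≡ u * a + v * b → k ∣ c
  ∣-lincomb u v k∣a k∣b refl = ∣m∣n⇒∣m+n (∣n⇒∣m*n u k∣a) (∣n⇒∣m*n v k∣b)

  ∣-multiple : ∀ {k a c} u → k ∣ a → c ≡ u * a → k ∣ c
  ∣-multiple u k∣a refl = ∣n⇒∣m*n u k∣a

  *-pres-∣ : ∀ {a b c d} → a ∣ b → c ∣ d → a * c ∣ b * d
  *-pres-∣ {b = b} {c} a∣b c∣d = ∣-trans (*-monoˡ-∣ c a∣b) (*-monoʳ-∣ b c∣d)

  ∤-positive : ∀ {p k} → 0 ℕ.< k → k ℕ.< p → ¬ (+ p ∣ + k)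
  ∤-positive 0<k k<p p∣k = ℕ∣.>⇒∤ {{ℕ.>-nonZero 0<k}} k<p (∣⇒∣ᵤ p∣k)

  residue-∣ : ∀ M .{{_ : NonZero M}} z → + M ∣ z - + (z %ℕ M)
  residue-∣ M z = ∣-multiple (z /ℕ M) ∣-refl
    (trans (cong (_- + (z %ℕ M)) (a≡a%ℕn+[a/ℕn]*n z M)) (cancel (+ (z %ℕ M)) (z /ℕ M) (+ M)))
    where
    cancel : ∀ r q M → (r + q * M) - r ≡ q * M
    cancel = solve-∀

  ≡-residue⇒∣ : ∀ M .{{_ : NonZero M}} a b → a %ℕ M ≡ b %ℕ M → + M ∣ a - b
  ≡-residue⇒∣ M a b eq = ∣-lincomb (+ 1) (- + 1) (residue-∣ M a)
    (subst (λ r → + M ∣ b - + r) (sym eq) (residue-∣ M b)) (split a b (+ (a %ℕ M)))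
    where
    split : ∀ a b r → a - b ≡ + 1 * (a - r) + - + 1 * (b - r)
    split = solve-∀

  positive-representative : ∀ M .{{_ : NonZero M}} z → ∃ λ a → 1 ℕ.≤ a × a ℕ.≤ M × + M ∣ + a - z
  positive-representative M z with z %ℕ M | n%ℕd<d z M | residue-∣ M z
  ... | zero  | _   | M∣z = M , ℕ.>-nonZero⁻¹ M , ℕₚ.≤-refl , ∣-lincomb (+ 1) (- + 1) ∣-refl M∣z (shift (+ M) z)
    where
    shift : ∀ M z → M - z ≡ + 1 * M + - + 1 * (z - + 0)
    shift = solve-∀
  ... | suc r | r<M | M∣z-r = suc r , s≤s z≤n , ℕₚ.<⇒≤ r<M , ∣-multiple (- + 1) M∣z-r (flip (+ suc r) z)
    where
    flip : ∀ r z → r - z ≡ - + 1 * (z - r)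
    flip = solve-∀

  ±-representative : ∀ h z → ¬ (+ suc (h ℕ.+ h) ∣ z) →
                     ∃ λ d → 1 ℕ.≤ d × d ℕ.≤ h × (+ suc (h ℕ.+ h) ∣ z - + d ⊎ + suc (h ℕ.+ h) ∣ z + + d)
  ±-representative h z M∤z with positive-representative (suc (h ℕ.+ h)) z
  ... | a , 1≤a , a≤M , M∣a-z with a ℕₚ.≤? h
  ...   | yes a≤h = a , 1≤a , a≤h , inj₁ (∣-multiple (- + 1) M∣a-z (flip z (+ a)))
    where
    flip : ∀ z a → z - a ≡ - + 1 * (a - z)
    flip = solve-∀
  ...   | no a≰h with ℕₚ.m≤n⇒m<n∨m≡n a≤M
  ...     | inj₂ refl = ⊥-elim (M∤z (∣-lincomb (+ 1) (- + 1) ∣-refl M∣a-z (back (+ M) z)))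
    where
    M = suc (h ℕ.+ h)
    back : ∀ M z → z ≡ + 1 * M + - + 1 * (M - z)
    back = solve-∀
  ...     | inj₁ a<M =
    M ℕ.∸ a , ℕₚ.m<n⇒0<n∸m a<M , d≤h , inj₂ (∣-lincomb (+ 1) (- + 1) ∣-refl M∣a-z z+d≡)
    where
    M = suc (h ℕ.+ h)
    d≤h : M ℕ.∸ a ℕ.≤ h
    d≤h = ℕₚ.≤-trans (ℕₚ.∸-monoʳ-≤ M (ℕₚ.≰⇒> a≰h)) (ℕₚ.≤-reflexive (ℕₚ.m+n∸m≡n (suc h) h))
    z+d≡ : z + + (M ℕ.∸ a) ≡ + 1 * + M + - + 1 * (+ a - z)
    z+d≡ = begin
      z + + (M ℕ.∸ a)       ≡⟨ cong (λ w → z + w) (sym (⊖-≥ (ℕₚ.<⇒≤ a<M))) ⟩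
      z + (M ⊖ a)           ≡⟨ cong (λ w → z + w) (sym (m-n≡m⊖n M a)) ⟩
      z + (+ M - + a)       ≡⟨ regroup z (+ M) (+ a) ⟩
      + 1 * + M + - + 1 * (+ a - z) ∎
      where
      open ≡-Reasoning
      regroup : ∀ z M a → z + (M - a) ≡ + 1 * M + - + 1 * (a - z)
      regroup = solve-∀

  prime-∣-* : ∀ {p} → Prime p → ∀ a b → + p ∣ a * b → + p ∣ a ⊎ + p ∣ b
  prime-∣-* {p} pr a b p∣ab
    with euclidsLemma ℤ.∣ a ∣ ℤ.∣ b ∣ pr (subst (p ℕ∣.∣_) (abs-* a b) (∣⇒∣ᵤ p∣ab))
  ... | inj₁ p∣a = inj₁ (∣ᵤ⇒∣ p∣a)
  ... | inj₂ p∣b = inj₂ (∣ᵤ⇒∣ p∣b)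

  prime-∤-* : ∀ {p} → Prime p → ∀ {a b} → ¬ (+ p ∣ a) → ¬ (+ p ∣ b) → ¬ (+ p ∣ a * b)
  prime-∤-* pr {a} {b} p∤a p∤b p∣ab with prime-∣-* pr a b p∣ab
  ... | inj₁ p∣a = p∤a p∣a
  ... | inj₂ p∣b = p∤b p∣b

  prime-∣-cancelˡ : ∀ {p} → Prime p → ∀ {a b} → ¬ (+ p ∣ a) → + p ∣ a * b → + p ∣ b
  prime-∣-cancelˡ pr {a} {b} p∤a p∣ab with prime-∣-* pr a b p∣ab
  ... | inj₁ p∣a = ⊥-elim (p∤a p∣a)
  ... | inj₂ p∣b = p∣b

  bézout⇒inverse : ∀ {p r} → Bézout.Identity 1 p r → ∃ λ u → + p ∣ + r * u - + 1
  bézout⇒inverse {p} {r} (Bézout.+- x y 1+yr≡xp) =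
    - + y , divides (- + x)
              (trans (negate (+ r) (+ y)) (trans (cong -_ (cast 1+yr≡xp)) (neg-* (+ x) (+ p))))
    where
    negate : ∀ r y → r * - y - + 1 ≡ - (+ 1 + y * r)
    negate = solve-∀
    neg-* : ∀ x p → - (x * p) ≡ - x * p
    neg-* = solve-∀
    cast : 1 ℕ.+ y ℕ.* r ≡ x ℕ.* p → + 1 + + y * + r ≡ + x * + p
    cast eq = trans (cong (λ w → + 1 + w) (sym (pos-* y r))) (trans (cong +_ eq) (pos-* x p))
  bézout⇒inverse {p} {r} (Bézout.-+ x y 1+xp≡yr) =
    + y , divides (+ x)
            (trans (reorder (+ r) (+ y)) (trans (cong (_- + 1) (sym (cast 1+xp≡yr))) (cancel (+ x) (+ p))))
    where
    reorder : ∀ r y → r * y - + 1 ≡ y * r - + 1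
    reorder = solve-∀
    cancel : ∀ x p → (+ 1 + x * p) - + 1 ≡ x * p
    cancel = solve-∀
    cast : 1 ℕ.+ x ℕ.* p ≡ y ℕ.* r → + 1 + + x * + p ≡ + y * + r
    cast eq = trans (cong (λ w → + 1 + w) (sym (pos-* x p))) (trans (cong +_ eq) (pos-* y r))

  inverse-mod-prime : ∀ {p} → Prime p → ∀ a → ¬ (+ p ∣ a) → ∃ λ u → + p ∣ a * u - + 1
  inverse-mod-prime {p} pr a p∤a with a %ℕ p | n%ℕd<d a p | residue-∣ p a
    where instance _ = prime⇒nonZero pr
  ... | zero  | _   | p∣a-0 = ⊥-elim (p∤a (∣-multiple (+ 1) p∣a-0 (drop-zero a)))
    where
    drop-zero : ∀ a → a ≡ + 1 * (a - + 0)
    drop-zero = solve-∀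
  ... | suc r | r<p | p∣a-r with bézout⇒inverse (coprime-Bézout (prime⇒coprime pr r<p))
  ...   | u , p∣ru-1 = u , ∣-lincomb u (+ 1) p∣a-r p∣ru-1 (split a (+ suc r) u)
    where
    split : ∀ a r u → a * u - + 1 ≡ u * (a - r) + + 1 * (r * u - + 1)
    split = solve-∀

  quadratic : ℤ → ℤ → ℤ → ℤ → ℤ
  quadratic α β γ x = α * x * x + β * x + γ

  quadratic-cong : ∀ {k} α β γ {x y} → k ∣ x - y → k ∣ quadratic α β γ y → k ∣ quadratic α β γ x
  quadratic-cong α β γ {x} {y} k∣x-y k∣fy = ∣-lincomb (α * (x + y) + β) (+ 1) k∣x-y k∣fy (difference α β γ x y)
    where
    difference : ∀ α β γ x y →
      α * x * x + β * x + γ ≡ (α * (x + y) + β) * (x - y) + + 1 * (α * y * y + β * y + γ)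
    difference = solve-∀

  quadratic-taylor : ∀ α β γ x t → quadratic α β γ (x + t) ≡ quadratic α β γ x + (+ 2 * α * x + β) * t + α * t * t
  quadratic-taylor = expanded
    where
    expanded : ∀ α β γ x t →
      α * (x + t) * (x + t) + β * (x + t) + γ ≡ (α * x * x + β * x + γ) + (+ 2 * α * x + β) * t + α * t * t
    expanded = solve-∀

  newton-step : ∀ α β γ x v →
    quadratic α β γ (x - quadratic α β γ x * v) ≡
    - + 1 * (((+ 2 * α * x + β) * v - + 1) * quadratic α β γ x) + α * v * v * (quadratic α β γ x * quadratic α β γ x)
  newton-step α β γ x v = trans (quadratic-taylor α β γ x (- (f * v))) (regroup f (+ 2 * α * x + β) α v)
    where
    f = quadratic α β γ x
    regroup : ∀ f f′ α v → f + f′ * - (f * v) + α * - (f * v) * - (f * v) ≡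
                           - + 1 * ((f′ * v - + 1) * f) + α * v * v * (f * f)
    regroup = solve-∀

  hensel-quadratic : ∀ {p} α β γ x₀ v → + p ∣ quadratic α β γ x₀ → + p ∣ (+ 2 * α * x₀ + β) * v - + 1 →
                     ∀ k → ∃ λ x → + p ∣ x - x₀ × + (p ^ suc k) ∣ quadratic α β γ x
  hensel-quadratic {p} α β γ x₀ v p∣fx₀ p∣f'v-1 zero =
    x₀ , ∣-multiple (+ 0) ∣-refl (cancel x₀ (+ p)) , ∣-trans (∣-reflexive (cong +_ (ℕₚ.*-identityʳ p))) p∣fx₀
    where
    cancel : ∀ x p → x - x ≡ + 0 * p
    cancel = solve-∀
  hensel-quadratic {p} α β γ x₀ v p∣fx₀ p∣f'v-1 (suc k)
    with x , p∣x-x₀ , pᵏ∣fx ← hensel-quadratic α β γ x₀ v p∣fx₀ p∣f'v-1 k =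
    x - f x * v , p∣x'-x₀ , subst (_∣ f (x - f x * v)) (sym (pos-* p (p ^ suc k))) pᵏ⁺¹∣fx'
    where
    f = quadratic α β γ
    p∣fx : + p ∣ f x
    p∣fx = ∣-trans (subst (+ p ∣_) (sym (pos-* p (p ^ k))) (∣m⇒∣m*n (+ (p ^ k)) ∣-refl)) pᵏ∣fx
    p∣x'-x₀ : + p ∣ (x - f x * v) - x₀
    p∣x'-x₀ = ∣-lincomb (+ 1) (- v) p∣x-x₀ p∣fx (shift x x₀ (f x) v)
      where
      shift : ∀ x x₀ fx v → (x - fx * v) - x₀ ≡ + 1 * (x - x₀) + - v * fx
      shift = solve-∀
    p∣f'xv-1 : + p ∣ (+ 2 * α * x + β) * v - + 1
    p∣f'xv-1 = ∣-lincomb (+ 1) (+ 2 * α * v) p∣f'v-1 p∣x-x₀ (derivative α β x x₀ v)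
      where
      derivative : ∀ α β x x₀ v →
        (+ 2 * α * x + β) * v - + 1 ≡ + 1 * ((+ 2 * α * x₀ + β) * v - + 1) + + 2 * α * v * (x - x₀)
      derivative = solve-∀
    pᵏ⁺¹∣fx' : + p * + (p ^ suc k) ∣ f (x - f x * v)
    pᵏ⁺¹∣fx' = ∣-lincomb (- + 1) (α * v * v) (*-pres-∣ p∣f'xv-1 pᵏ∣fx) (*-pres-∣ p∣fx pᵏ∣fx)
                 (newton-step α β γ x v)

  -- p ∣ conic X Y says that −3X² − 12 is the square Y² modulo p;
  -- for X = δx this is the condition defining ℓ_p(δ).
  conic : ℤ → ℤ → ℤ
  conic X Y = Y * Y + + 3 * X * X + + 12

  cofactor : ℤ → ℤ → ℤ
  cofactor a D = quadratic (+ 3) (+ 3 * D) (D * D + + 1) a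

  cofactor-root : ∀ {M} c D Y → + M ∣ + 6 * c - + 1 → + M ∣ conic D Y →
                  ∃ λ a → + M ∣ cofactor a D × + M ∣ (+ 2 * + 3 * a + + 3 * D) - Y
  cofactor-root {M} c D Y M∣6c-1 M∣conic = a , M∣Q , M∣T-Y
    where
    a = c * (Y - + 3 * D)
    M∣T-Y : + M ∣ (+ 2 * + 3 * a + + 3 * D) - Y
    M∣T-Y = ∣-multiple (Y - + 3 * D) M∣6c-1 (factor c D Y)
      where
      factor : ∀ c D Y → (+ 2 * + 3 * (c * (Y - + 3 * D)) + + 3 * D) - Y ≡ (Y - + 3 * D) * (+ 6 * c - + 1)
      factor = solve-∀
    M∣12Q : + M ∣ + 12 * cofactor a D
    M∣12Q = ∣-lincomb (+ 1) (+ 2 * + 3 * a + + 3 * D + Y) M∣conic M∣T-Y (complete-square a D Y)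
      where
      complete-square : ∀ a D Y →
        + 12 * (+ 3 * a * a + + 3 * D * a + (D * D + + 1)) ≡
        + 1 * (Y * Y + + 3 * D * D + + 12) + (+ 2 * + 3 * a + + 3 * D + Y) * ((+ 2 * + 3 * a + + 3 * D) - Y)
      complete-square = solve-∀
    M∣Q : + M ∣ cofactor a D
    M∣Q = ∣-lincomb (+ 3 * c * c) (- (cofactor a D * (+ 6 * c + + 1))) M∣12Q M∣6c-1
            (divide-by-12 c (cofactor a D))
      where
      divide-by-12 : ∀ c q → q ≡ + 3 * c * c * (+ 12 * q) + - (q * (+ 6 * c + + 1)) * (+ 6 * c - + 1)
      divide-by-12 = solve-∀

  pos-cube+ : ∀ x → + (x ^ 3 ℕ.+ x) ≡ + x * + x * + x + + x
  pos-cube+ x = begin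
    + (x ^ 3 ℕ.+ x)                        ≡⟨ pos-+ (x ^ 3) x ⟩
    + (x ℕ.* (x ℕ.* (x ℕ.* 1))) + + x        ≡⟨ cong (_+ + x) (pos-* x (x ℕ.* (x ℕ.* 1))) ⟩
    + x * + (x ℕ.* (x ℕ.* 1)) + + x          ≡⟨ cong (λ w → + x * w + + x) (pos-* x (x ℕ.* 1)) ⟩
    + x * (+ x * + (x ℕ.* 1)) + + x          ≡⟨ cong (λ w → + x * (+ x * w) + + x) (pos-* x 1) ⟩
    + x * (+ x * (+ x * + 1)) + + x          ≡⟨ reassociate (+ x) ⟩
    + x * + x * + x + + x                  ∎
    where
    open ≡-Reasoning
    reassociate : ∀ x → x * (x * (x * + 1)) + x ≡ x * x * x + x
    reassociate = solve-∀

  cube+-difference : ∀ a D → + ((a ℕ.+ D) ^ 3 ℕ.+ (a ℕ.+ D)) - + (a ^ 3 ℕ.+ a) ≡ + D * cofactor (+ a) (+ D)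
  cube+-difference a D = begin
    + ((a ℕ.+ D) ^ 3 ℕ.+ (a ℕ.+ D)) - + (a ^ 3 ℕ.+ a)
      ≡⟨ cong₂ _-_ (pos-cube+ (a ℕ.+ D)) (pos-cube+ a) ⟩
    (+ (a ℕ.+ D) * + (a ℕ.+ D) * + (a ℕ.+ D) + + (a ℕ.+ D)) - (+ a * + a * + a + + a)
      ≡⟨ cong (λ b → (b * b * b + b) - (+ a * + a * + a + + a)) (pos-+ a D) ⟩
    ((+ a + + D) * (+ a + + D) * (+ a + + D) + (+ a + + D)) - (+ a * + a * + a + + a)
      ≡⟨ factor (+ a) (+ D) ⟩
    + D * cofactor (+ a) (+ D) ∎
    where
    open ≡-Reasoning
    factor : ∀ a D → ((a + D) * (a + D) * (a + D) + (a + D)) - (a * a * a + a) ≡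
                     D * (+ 3 * a * a + + 3 * D * a + (D * D + + 1))
    factor = solve-∀

  collision : ∀ {n δ d M m} .{{_ : NonZero M}} → m ≡ δ ℕ.* M → 1 ℕ.≤ δ → 1 ℕ.≤ d →
              M ℕ.+ δ ℕ.* d ℕ.≤ n → ∀ x → + M ∣ cofactor x (+ (δ ℕ.* d)) → CollisionUpTo n m
  collision {n} {δ} {d} {M} refl 1≤δ 1≤d M+D≤n x M∣Qx
    with a , 1≤a , a≤M , M∣a-x ← positive-representative M x =
    a , a ℕ.+ D , 1≤a , ℕₚ.m<m+n a (ℕₚ.*-mono-≤ 1≤δ 1≤d) ,
    ℕₚ.≤-trans (ℕₚ.+-monoˡ-≤ D a≤M) M+D≤n ,
    ∣⇒∣ᵤ (subst₂ _∣_ (sym (pos-* δ M)) (sym (cube+-difference a D)) (*-pres-∣ δ∣D M∣Qa))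
    where
    D = δ ℕ.* d
    δ∣D : + δ ∣ + D
    δ∣D = subst (+ δ ∣_) (sym (pos-* δ d)) (∣m⇒∣m*n (+ d) ∣-refl)
    M∣Qa : + M ∣ cofactor (+ a) (+ D)
    M∣Qa = quadratic-cong (+ 3) (+ 3 * + D) (+ D * + D + + 1) {+ a} {x} M∣a-x M∣Qx

  odd-prime : ∀ {p} → Prime p → 3 ℕ.≤ p → p ≡ suc ((p ℕ.∸ 1) ℕ./ 2 ℕ.+ (p ℕ.∸ 1) ℕ./ 2)
  odd-prime {suc q} pr (s≤s 2≤q) with q ℕ.% 2 | m%n<n q 2 | m≡m%n+[m/n]*n q 2
  ... | zero          | _ | q≡2h = cong suc (trans q≡2h (double (q ℕ./ 2)))
    where
    double : ∀ h → h ℕ.* 2 ≡ h ℕ.+ h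
    double h = trans (ℕₚ.*-comm h 2) (cong (h ℕ.+_) (ℕₚ.+-identityʳ h))
  ... | suc zero      | _ | q≡2h+1 with prime⇒irreducible pr (ℕ∣.divides (suc (q ℕ./ 2)) (cong suc q≡2h+1))
  ...   | inj₁ ()
  ...   | inj₂ 2≡p = ⊥-elim (ℕₚ.<⇒≢ (s≤s 2≤q) 2≡p)
  odd-prime {suc q} pr (s≤s 2≤q) | suc (suc _) | s≤s (s≤s ()) | _

  distinct-squares-mod-prime : ∀ {p u v} → Prime p → u ℕ.< v → u ℕ.+ v ℕ.< p → ¬ (+ p ∣ + u * + u - + v * + v)
  distinct-squares-mod-prime {p} {u} {v} pr u<v u+v<p p∣u²-v²
    with prime-∣-* pr (+ v - + u) (+ u + + v) (∣-multiple (- + 1) p∣u²-v² (factor (+ u) (+ v)))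
    where
    factor : ∀ u v → (v - u) * (u + v) ≡ - + 1 * (u * u - v * v)
    factor = solve-∀
  ... | inj₁ p∣v-u = ∤-positive (ℕₚ.m<n⇒0<n∸m u<v) (ℕₚ.≤-<-trans (ℕₚ.m∸n≤m v u) v<p)
                       (subst (+ p ∣_) (trans (m-n≡m⊖n v u) (⊖-≥ (ℕₚ.<⇒≤ u<v))) p∣v-u)
    where
    v<p : v ℕ.< p
    v<p = ℕₚ.≤-<-trans (ℕₚ.m≤n+m v u) u+v<p
  ... | inj₂ p∣u+v = ∤-positive (ℕₚ.<-≤-trans (ℕₚ.≤-<-trans z≤n u<v) (ℕₚ.m≤n+m v u)) u+v<p
                       (subst (+ p ∣_) (sym (pos-+ u v)) p∣u+v)

  conic-point : ∀ {p} h → Prime p → p ≡ suc (h ℕ.+ h) → ¬ (+ p ∣ + 3) → ∃₂ λ x y → + p ∣ conic x y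
  conic-point {p} h pr refl p∤3
    = let i , j , i<j , same = pigeonhole (ℕₚ.n<1+n p) (λ i → residue (value (toℕ i))) in
      from-collision (toℕ≤pred[n] j) i<j
        (≡-residue⇒∣ p (value (toℕ i)) (value (toℕ j)) (fromℕ<-injective _ _ _ _ same))
    where
    residue : ℤ → Fin p
    residue z = fromℕ< (n%ℕd<d z p)

    value : ℕ → ℤ
    value i with i ℕₚ.≤? h
    ... | yes _ = + i * + i
    ... | no  _ = - (+ 3 * + (i ℕ.∸ suc h) * + (i ℕ.∸ suc h) + + 12)

    sum-< : ∀ {u v} → u ℕ.< v → v ℕ.≤ h → u ℕ.+ v ℕ.< p
    sum-< u<v v≤h = s≤s (ℕₚ.+-mono-≤ (ℕₚ.≤-trans (ℕₚ.<⇒≤ u<v) v≤h) v≤h)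

    from-collision : ∀ {I J} → J ℕ.≤ p → I ℕ.< J → + p ∣ value I - value J → ∃₂ λ x y → + p ∣ conic x y
    -- Abstracting over the two decisions also unfolds value I and value J in p∣vI-vJ.
    from-collision {I} {J} J≤p I<J p∣vI-vJ with I ℕₚ.≤? h | J ℕₚ.≤? h
    ... | yes I≤h | yes J≤h =
      ⊥-elim (distinct-squares-mod-prime pr I<J (sum-< I<J J≤h) p∣vI-vJ)
    ... | yes I≤h | no J≰h =
      + (J ℕ.∸ suc h) , + I , ∣-multiple (+ 1) p∣vI-vJ (as-difference (+ I) (+ (J ℕ.∸ suc h)))
      where
      as-difference : ∀ y x → y * y + + 3 * x * x + + 12 ≡ + 1 * (y * y - - (+ 3 * x * x + + 12))
      as-difference = solve-∀
    ... | no I≰h | yes J≤h = ⊥-elim (I≰h (ℕₚ.≤-trans (ℕₚ.<⇒≤ I<J) J≤h))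
    ... | no I≰h | no J≰h =
      ⊥-elim (distinct-squares-mod-prime pr a<b (sum-< a<b b≤h) (prime-∣-cancelˡ pr p∤3 p∣3[a²-b²]))
      where
      a = I ℕ.∸ suc h
      b = J ℕ.∸ suc h
      a<b : a ℕ.< b
      a<b = ℕₚ.∸-monoˡ-< I<J (ℕₚ.≰⇒> I≰h)
      b≤h : b ℕ.≤ h
      b≤h = ℕₚ.≤-trans (ℕₚ.∸-monoˡ-≤ (suc h) J≤p) (ℕₚ.≤-reflexive (ℕₚ.m+n∸m≡n h h))
      p∣3[a²-b²] : + p ∣ + 3 * (+ a * + a - + b * + b)
      p∣3[a²-b²] = ∣-multiple (- + 1) p∣vI-vJ (shifted-difference (+ a) (+ b))
        where
        shifted-difference : ∀ a b → + 3 * (a * a - b * b) ≡ - + 1 * (- (+ 3 * a * a + + 12) - - (+ 3 * b * b + + 12))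
        shifted-difference = solve-∀

  UnitConicPoint : ℕ → Set
  UnitConicPoint p = ∃₂ λ X Y → ¬ (+ p ∣ X) × ¬ (+ p ∣ Y) × + p ∣ conic X Y

  unit-conic-point-from-x²≡-4 : ∀ {p} → Prime p → ¬ (+ p ∣ + 2) → ¬ (+ p ∣ + 3) →
                                ∀ x → + p ∣ x * x + + 4 → UnitConicPoint p
  unit-conic-point-from-x²≡-4 {p} pr p∤2 p∤3 x p∣x²+4 =
    i , + 3 * i , p∤i , prime-∤-* pr p∤3 p∤i , ∣-multiple (+ 12) p∣i²+1 (twelve i)
    where
    w = proj₁ (inverse-mod-prime pr (+ 2) p∤2)
    p∣2w-1 = proj₂ (inverse-mod-prime pr (+ 2) p∤2)
    i = x * w
    p∣4[i²+1] : + p ∣ + 4 * (i * i + + 1)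
    p∣4[i²+1] = ∣-lincomb (+ 1) (x * x * (+ 2 * w + + 1)) p∣x²+4 p∣2w-1 (halve x w)
      where
      halve : ∀ x w → + 4 * ((x * w) * (x * w) + + 1) ≡
                      + 1 * (x * x + + 4) + x * x * (+ 2 * w + + 1) * (+ 2 * w - + 1)
      halve = solve-∀
    p∣i²+1 : + p ∣ i * i + + 1
    p∣i²+1 = prime-∣-cancelˡ pr (prime-∤-* pr p∤2 p∤2) p∣4[i²+1]
    p∤i : ¬ (+ p ∣ i)
    p∤i p∣i = p∤2 (∣-lincomb (+ 2) (- (+ 2 * i)) p∣i²+1 p∣i (unit i))
      where
      unit : ∀ i → + 2 ≡ + 2 * (i * i + + 1) + - (+ 2 * i) * i
      unit = solve-∀
    twelve : ∀ i → (+ 3 * i) * (+ 3 * i) + + 3 * i * i + + 12 ≡ + 12 * (i * i + + 1)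
    twelve = solve-∀

  unit-conic-point-from-y²≡-12 : ∀ {p} → Prime p → ¬ (+ p ∣ + 2) → ¬ (+ p ∣ + 3) →
                                 ∀ y → ¬ (+ p ∣ y) → + p ∣ y * y + + 12 → UnitConicPoint p
  unit-conic-point-from-y²≡-12 {p} pr p∤2 p∤3 y p∤y p∣y²+12 = + 2 * y * t , + 2 , p∤2yt , p∤2 , p∣conic
    where
    t = proj₁ (inverse-mod-prime pr (+ 3) p∤3)
    p∣3t-1 = proj₂ (inverse-mod-prime pr (+ 3) p∤3)
    p∤t : ¬ (+ p ∣ t)
    p∤t p∣t = p∤2 (∣-lincomb (- + 2) (+ 6) p∣3t-1 p∣t (unit t))
      where
      unit : ∀ t → + 2 ≡ - + 2 * (+ 3 * t - + 1) + + 6 * t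
      unit = solve-∀
    p∤2yt : ¬ (+ p ∣ + 2 * y * t)
    p∤2yt = prime-∤-* pr (prime-∤-* pr p∤2 p∤y) p∤t
    p∣conic : + p ∣ conic (+ 2 * y * t) (+ 2)
    p∣conic = prime-∣-cancelˡ pr p∤3
      (∣-lincomb (+ 4) (+ 4 * y * y * (+ 3 * t + + 1)) p∣y²+12 p∣3t-1 (scale y t))
      where
      scale : ∀ y t → + 3 * (+ 2 * + 2 + + 3 * (+ 2 * y * t) * (+ 2 * y * t) + + 12) ≡
                      + 4 * (y * y + + 12) + + 4 * y * y * (+ 3 * t + + 1) * (+ 3 * t - + 1)
      scale = solve-∀

  unit-conic-point : ∀ {p} → Prime p → ¬ (+ p ∣ + 2) → ¬ (+ p ∣ + 3) →
                     ∀ x y → + p ∣ conic x y → UnitConicPoint p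
  unit-conic-point {p} pr p∤2 p∤3 x y p∣conic with + p ∣? y | + p ∣? x
  ... | yes p∣y | _ = unit-conic-point-from-x²≡-4 pr p∤2 p∤3 x
    (prime-∣-cancelˡ pr p∤3 (∣-lincomb (+ 1) (- y) p∣conic p∣y (drop-y x y)))
    where
    drop-y : ∀ x y → + 3 * (x * x + + 4) ≡ + 1 * (y * y + + 3 * x * x + + 12) + - y * y
    drop-y = solve-∀
  ... | no p∤y | yes p∣x = unit-conic-point-from-y²≡-12 pr p∤2 p∤3 y p∤y
    (∣-lincomb (+ 1) (- (+ 3 * x)) p∣conic p∣x (drop-x x y))
    where
    drop-x : ∀ x y → y * y + + 12 ≡ + 1 * (y * y + + 3 * x * x + + 12) + - (+ 3 * x) * x
    drop-x = solve-∀
  ... | no p∤y | no p∤x = x , y , p∤x , p∤y , p∣conic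

  conic-point-at-multiple : ∀ {p δ} h X Y → Prime p → p ≡ suc (h ℕ.+ h) → ¬ (+ p ∣ + δ) → ¬ (+ p ∣ X) →
                            + p ∣ conic X Y → ∃ λ d → 1 ℕ.≤ d × d ℕ.≤ h × + p ∣ conic (+ (δ ℕ.* d)) Y
  conic-point-at-multiple {p} {δ} h X Y pr refl p∤δ p∤X p∣conic
    = let d , 1≤d , d≤h , p∣Xu∓d = ±-representative h (X * u) p∤Xu in
      d , 1≤d , d≤h ,
      subst (λ D → + p ∣ conic D Y) (sym (pos-* δ d))
        (∣-lincomb (+ 1) (+ 3) p∣conic (p∣D²-X² d p∣Xu∓d) (shift (+ δ * + d) X Y))
    where
    u = proj₁ (inverse-mod-prime pr (+ δ) p∤δ)
    p∣δu-1 = proj₂ (inverse-mod-prime pr (+ δ) p∤δ)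
    p∤Xu : ¬ (+ p ∣ X * u)
    p∤Xu p∣Xu = p∤X (∣-lincomb (+ δ) (- X) p∣Xu p∣δu-1 (cancel-u X u (+ δ)))
      where
      cancel-u : ∀ X u δ → X ≡ δ * (X * u) + - X * (δ * u - + 1)
      cancel-u = solve-∀
    p∣D²-X² : ∀ d → + p ∣ X * u - + d ⊎ + p ∣ X * u + + d → + p ∣ (+ δ * + d - X) * (+ δ * + d + X)
    p∣D²-X² d (inj₁ p∣Xu-d) = ∣m⇒∣m*n (+ δ * + d + X)
      (∣-lincomb (- + δ) X p∣Xu-d p∣δu-1 (minus (+ δ) (+ d) X u))
      where
      minus : ∀ δ d X u → δ * d - X ≡ - δ * (X * u - d) + X * (δ * u - + 1)
      minus = solve-∀
    p∣D²-X² d (inj₂ p∣Xu+d) = ∣n⇒∣m*n (+ δ * + d - X)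
      (∣-lincomb (+ δ) (- X) p∣Xu+d p∣δu-1 (plus (+ δ) (+ d) X u))
      where
      plus : ∀ δ d X u → δ * d + X ≡ δ * (X * u + d) + - X * (δ * u - + 1)
      plus = solve-∀
    shift : ∀ D X Y → Y * Y + + 3 * D * D + + 12 ≡ + 1 * (Y * Y + + 3 * X * X + + 12) + + 3 * ((D - X) * (D + X))
    shift = solve-∀

  ℓ-conic-point : ∀ {p} δ l → EllCond p δ l → ∃ λ Y → + p ∣ conic (+ (δ ℕ.* l)) Y
  ℓ-conic-point {p} δ l (inj₁ p∣E) =
    + 0 , subst (λ D → + p ∣ conic D (+ 0)) (sym (pos-* δ l))
            (∣-multiple (- + 1) (∣ᵤ⇒∣ p∣E) (zero-root (+ δ) (+ l)))
    where
    zero-root : ∀ δ l → + 0 * + 0 + + 3 * (δ * l) * (δ * l) + + 12 ≡ - + 1 * (- + 3 * δ * δ * l * l - + 12)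
    zero-root = solve-∀
  ℓ-conic-point {p} δ l (inj₂ (y , p∣y²-E)) =
    y , subst (λ D → + p ∣ conic D y) (sym (pos-* δ l))
          (∣-multiple (+ 1) (∣ᵤ⇒∣ p∣y²-E) (square-root y (+ δ) (+ l)))
    where
    square-root : ∀ y δ l → y * y + + 3 * (δ * l) * (δ * l) + + 12 ≡ + 1 * (y * y - (- + 3 * δ * δ * l * l - + 12))
    square-root = solve-∀

  ≥5⇒∤2 : ∀ {p} → 5 ℕ.≤ p → ¬ (+ p ∣ + 2)
  ≥5⇒∤2 5≤p = ∤-positive (s≤s z≤n) (ℕₚ.<-≤-trans (s≤s (s≤s (s≤s z≤n))) 5≤p)

  ≥5⇒∤3 : ∀ {p} → 5 ℕ.≤ p → ¬ (+ p ∣ + 3)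
  ≥5⇒∤3 5≤p = ∤-positive (s≤s z≤n) (ℕₚ.<-≤-trans (s≤s (s≤s (s≤s (s≤s z≤n)))) 5≤p)

  prime-power-collision : ∀ {n δ p m} k → 1 ℕ.≤ δ → Prime p → 5 ℕ.≤ p → ¬ (+ p ∣ + δ) →
                          m ≡ δ ℕ.* p ^ suc k → p ^ suc k ℕ.+ δ ℕ.* ((p ℕ.∸ 1) ℕ./ 2) ℕ.≤ n → CollisionUpTo n m
  prime-power-collision {n} {δ} {p} k 1≤δ pr 5≤p p∤δ m≡ bound =
    let x , y , p∣xy                   = conic-point h pr p≡1+2h p∤3
        X , Y , p∤X , p∤Y , p∣XY       = unit-conic-point pr p∤2 p∤3 x y p∣xy
        d , 1≤d , d≤h , p∣DY           = conic-point-at-multiple h X Y pr p≡1+2h p∤δ p∤X p∣XY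
        D                              = + (δ ℕ.* d)
        c , p∣6c-1                     = inverse-mod-prime pr (+ 6) (prime-∤-* pr p∤2 p∤3)
        a₀ , p∣Qa₀ , p∣T-Y             = cofactor-root c D Y p∣6c-1 p∣DY
        T                              = + 2 * + 3 * a₀ + + 3 * D
        p∤T                            = λ p∣T → p∤Y (∣-lincomb (+ 1) (- + 1) p∣T p∣T-Y (back T Y))
        v , p∣Tv-1                     = inverse-mod-prime pr T p∤T
        a , _ , pʳ∣Qa                  = hensel-quadratic (+ 3) (+ 3 * D) (D * D + + 1) a₀ v p∣Qa₀ p∣Tv-1 k
        bound′                         = ℕₚ.≤-trans (ℕₚ.+-monoʳ-≤ (p ^ suc k) (ℕₚ.*-monoʳ-≤ δ d≤h)) bound
    in collision m≡ 1≤δ 1≤d bound′ a pʳ∣Qa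
    where
    instance
      _ = prime⇒nonZero pr
      _ = ℕₚ.m^n≢0 p (suc k)
    h = (p ℕ.∸ 1) ℕ./ 2
    p≡1+2h = odd-prime pr (ℕₚ.≤-trans (s≤s (s≤s (s≤s z≤n))) 5≤p)
    p∤2 = ≥5⇒∤2 5≤p
    p∤3 = ≥5⇒∤3 5≤p
    back : ∀ T Y → Y ≡ + 1 * T + - + 1 * (T - Y)
    back = solve-∀

  ℓ-collision : ∀ {n δ p m l} → 1 ℕ.≤ δ → Prime p → 5 ℕ.≤ p → m ≡ δ ℕ.* p →
                1 ℕ.≤ l → EllCond p δ l → p ℕ.+ δ ℕ.* l ℕ.≤ n → CollisionUpTo n m
  ℓ-collision {δ = δ} {l = l} 1≤δ pr 5≤p m≡ 1≤l ℓ-cond bound =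
    let Y , p∣DY = ℓ-conic-point δ l ℓ-cond
        c , p∣6c-1 = inverse-mod-prime pr (+ 6) (prime-∤-* pr p∤2 p∤3)
        a₀ , p∣Qa₀ , _ = cofactor-root c (+ (δ ℕ.* l)) Y p∣6c-1 p∣DY
    in collision m≡ 1≤δ 1≤l bound a₀ p∣Qa₀
    where
    instance _ = prime⇒nonZero pr
    p∤2 = ≥5⇒∤2 5≤p
    p∤3 = ≥5⇒∤3 5≤p


open import Defs
open import Data.Nat using (ℕ; _+_; _*_; _∸_; _^_; _/_; _≤_)
open import Data.Nat.Divisibility using (_∣_)
open import Data.Nat.Primality using (Prime)
open import Data.Product using (_×_)
open import Relation.Nullary using (¬_)
open import Relation.Binary.PropositionalEquality using (_≡_)
open import Data.Nat using (suc; s≤s; z≤n)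
open import Data.Nat.Properties using (*-identityʳ)
open import Data.Product using (_,_)
open import Relation.Binary.PropositionalEquality using (refl; trans; cong)
open import Data.Integer.Divisibility.Signed using (∣⇒∣ᵤ)
open CubicCollisions using (prime-power-collision; ℓ-collision)

lemma3p3 : (n δ r p m : ℕ) → 1 ≤ n → 1 ≤ δ → 1 ≤ r → Prime p → 5 ≤ p →
           ¬ (p ∣ δ) → m ≡ δ * p ^ r →
           ((p ^ r + δ * ((p ∸ 1) / 2) ≤ n → CollisionUpTo n m)
           × (r ≡ 1 → (l : ℕ) → IsEll p δ l → p + δ * l ≤ n → CollisionUpTo n m))
lemma3p3 n δ (suc k) p m _ 1≤δ (s≤s z≤n) pr 5≤p p∤δ m≡ =
  prime-power-collision k 1≤δ pr 5≤p (λ p∣δ → p∤δ (∣⇒∣ᵤ p∣δ)) m≡ , at-ℓ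
  where
  at-ℓ : suc k ≡ 1 → (l : ℕ) → IsEll p δ l → p + δ * l ≤ n → CollisionUpTo n m
  at-ℓ refl l (1≤l , ℓ-cond , _) = ℓ-collision 1≤δ pr 5≤p (trans m≡ (cong (δ *_) (*-identityʳ p))) 1≤l ℓ-cond
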